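{- Define integers $a_{\mathcal{G}}(n)$, $n\ge0$, by $a_{\mathcal{G}}(0)=1$, $a_{\mathcal{G}}(1)=-1$, $a_{\mathcal{G}}(2)=-1$ and, for $n\ge3$, $$a_{\mathcal{G}}(n)=-\frac12\left(\sum_{k=0}^{n-2}a_{\mathcal{G}}(k)\binom{n-1}{k}2^{n-1-k}+\sum_{k=0}^{n-1}a_{\mathcal{G}}(k)\binom{n}{k}2^{n-k}\right).$$ Then $a_{\mathcal{G}}(2n)=a_{\mathcal{G}}(2n-1)$ for all $n\ge1$. -}

module Defs where

open import Data.Nat using (ℕ; zero; suc; _∸_; _^_) renaming (_*_ to _*ℕ_)
open import Data.Nat.Combinatorics using (_C_)
open import Data.Integer using (ℤ; +_; -_; _+_; _*_; -1ℤ; 1ℤ; 0ℤ)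
open import Data.Integer.DivMod using (_/_)
open import Data.List using (List; []; _∷_; _++_; [_]; upTo; map; foldr; length)

sumℤ : List ℤ → ℤ
sumℤ = foldr _+_ 0ℤ

-- k-th element of a list (0 if out of range; never used out of range below)
at : List ℤ → ℕ → ℤ
at []       _       = 0ℤ
at (x ∷ xs) zero    = x
at (x ∷ xs) (suc k) = at xs k

-- the recurrence step: given the list vs = [a(0), …, a(n-1)], compute a(n)
step : ℕ → List ℤ → ℤ
step 0 vs = 1ℤ
step 1 vs = -1ℤ
step 2 vs = -1ℤ
step n@(suc (suc (suc _))) vs =
  - ((S₁ + S₂) / (+ 2))
  where
    S₁ : ℤ
    S₁ = sumℤ (map (λ k → at vs k * (+ (((n ∸ 1) C k) *ℕ 2 ^ (n ∸ 1 ∸ k)))) (upTo (n ∸ 1)))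
    S₂ : ℤ
    S₂ = sumℤ (map (λ k → at vs k * (+ ((n C k) *ℕ 2 ^ (n ∸ k)))) (upTo n))

prefix : ℕ → List ℤ
prefix zero    = []
prefix (suc n) = prefix n ++ [ step n (prefix n) ]

aG : ℕ → ℤ
aG n = step n (prefix n)

-- Let S(n) = Σ_{k≤n} C(n,k) 2^(n-k) a(k) be the binomial transform of a = a_G with shift 2.
-- The two sums in the recurrence are S(n-1) - a(n-1) and S(n) - a(n), so it reads
-- a(n) = a(n-1) - S(n-1) - S(n).  The key fact is S(n) = (-1)^n a(n), by strong induction on
-- the defect D(n) = S(n) - (-1)^n a(n): the transforms with shifts 2 and -2 are mutually
-- inverse and the shift -2 transform of (-1)^k a(k) is (-1)^n S(n), so the shift -2 transform
-- of D is -(-1)^n D.  If D vanishes below n that transform equals D(n), which forces D(n) = 0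
-- for even n; for odd n the recurrence gives it directly.  At n = 2m+2 the recurrence then
-- reads a(2m+2) = a(2m+1) + a(2m+1) - a(2m+2).
module Submission where

open import Defs
open import Data.Nat as ℕ using (ℕ; zero; suc; _∸_; _≤_; _<_)
  renaming (_*_ to _*ℕ_; _+_ to _+ℕ_; _^_ to _^ℕ_)
import Data.Nat.Properties as ℕ
import Data.Nat.DivMod as ℕ
open import Data.Nat.Induction using (<-rec)
open import Data.Nat.Combinatorics using (_C_; k>n⇒nCk≡0; nCn≡1; nCk+nC[k+1]≡[n+1]C[k+1])
open import Data.Integer using (ℤ; +_; -[1+_]; -_; _+_; _-_; _*_; _^_; -1ℤ; 0ℤ; 1ℤ)
open import Data.Integer.Properties
open import Data.Integer.DivMod using (_/_)
open import Data.Integer.Tactic.RingSolver using (solve-∀)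
open import Data.List using (List; []; _∷_; _++_; [_]; upTo; applyUpTo; map; length)
import Data.List.Properties as List
open import Data.Sum using (_⊎_; inj₁; inj₂)
open import Function using (_∘_)
open import Relation.Binary.PropositionalEquality
  using (_≡_; refl; sym; trans; cong; cong₂; subst; module ≡-Reasoning)
open import Relation.Nullary using (yes; no)
open ≡-Reasoning

Σ< : ℕ → (ℕ → ℤ) → ℤ
Σ< zero    f = 0ℤ
Σ< (suc m) f = f 0 + Σ< m (f ∘ suc)

sumℤ-map-applyUpTo : ∀ m (g : ℕ → ℕ) (f : ℕ → ℤ) → sumℤ (map f (applyUpTo g m)) ≡ Σ< m (f ∘ g)
sumℤ-map-applyUpTo zero    g f = refl
sumℤ-map-applyUpTo (suc m) g f = cong (_+_ (f (g 0))) (sumℤ-map-applyUpTo m (g ∘ suc) f)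

Σ<-cong : ∀ m {f g : ℕ → ℤ} → (∀ {k} → k < m → f k ≡ g k) → Σ< m f ≡ Σ< m g
Σ<-cong zero    eq = refl
Σ<-cong (suc m) eq = cong₂ _+_ (eq (ℕ.s≤s ℕ.z≤n)) (Σ<-cong m (eq ∘ ℕ.s≤s))

Σ<-last : ∀ m (f : ℕ → ℤ) → Σ< (suc m) f ≡ Σ< m f + f m
Σ<-last zero    f = trans (+-identityʳ (f 0)) (sym (+-identityˡ (f 0)))
Σ<-last (suc m) f = begin
  f 0 + Σ< (suc m) (f ∘ suc)         ≡⟨ cong (_+_ (f 0)) (Σ<-last m (f ∘ suc)) ⟩
  f 0 + (Σ< m (f ∘ suc) + f (suc m)) ≡⟨ sym (+-assoc (f 0) _ _) ⟩
  Σ< (suc m) f + f (suc m)           ∎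

*-distribˡ-Σ< : ∀ m c (f : ℕ → ℤ) → c * Σ< m f ≡ Σ< m (λ k → c * f k)
*-distribˡ-Σ< zero    c f = *-zeroʳ c
*-distribˡ-Σ< (suc m) c f =
  trans (*-distribˡ-+ c (f 0) _) (cong (_+_ (c * f 0)) (*-distribˡ-Σ< m c (f ∘ suc)))

Σ<-distrib-+ : ∀ m (f g : ℕ → ℤ) → Σ< m (λ k → f k + g k) ≡ Σ< m f + Σ< m g
Σ<-distrib-+ zero    f g = refl
Σ<-distrib-+ (suc m) f g = begin
  f 0 + g 0 + Σ< m (λ k → f (suc k) + g (suc k))
    ≡⟨ cong (_+_ (f 0 + g 0)) (Σ<-distrib-+ m (f ∘ suc) (g ∘ suc)) ⟩
  f 0 + g 0 + (Σ< m (f ∘ suc) + Σ< m (g ∘ suc))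
    ≡⟨ interchange (f 0) (g 0) _ _ ⟩
  f 0 + Σ< m (f ∘ suc) + (g 0 + Σ< m (g ∘ suc)) ∎
  where
  interchange : ∀ a b c d → a + b + (c + d) ≡ a + c + (b + d)
  interchange = solve-∀

-- binomialTransform x f n = Σ_{k≤n} C(n,k) x^(n-k) f(k) (see Σ<-binomial); defining it by
-- Pascal's rule makes its algebraic properties provable by plain induction on n.
binomialTransform : ℤ → (ℕ → ℤ) → ℕ → ℤ
binomialTransform x f zero    = f 0
binomialTransform x f (suc n) = x * binomialTransform x f n + binomialTransform x (f ∘ suc) n

module _ (x : ℤ) where

  binomialTransform-cong : ∀ n {f g : ℕ → ℤ} → (∀ k → f k ≡ g k) →
                           binomialTransform x f n ≡ binomialTransform x g n
  binomialTransform-cong zero    eq = eq 0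
  binomialTransform-cong (suc n) eq =
    cong₂ (λ u v → x * u + v) (binomialTransform-cong n eq) (binomialTransform-cong n (eq ∘ suc))

  binomialTransform-linear : ∀ n c (f g : ℕ → ℤ) →
    binomialTransform x (λ k → c * f k + g k) n ≡ c * binomialTransform x f n + binomialTransform x g n
  binomialTransform-linear zero    c f g = refl
  binomialTransform-linear (suc n) c f g =
    trans (cong₂ (λ u v → x * u + v) (binomialTransform-linear n c f g)
                                     (binomialTransform-linear n c (f ∘ suc) (g ∘ suc)))
          (regroup x c _ _ _ _)
    where
    regroup : ∀ x c a b p q → x * (c * a + b) + (c * p + q) ≡ c * (x * a + p) + (x * b + q)
    regroup = solve-∀

  binomialTransform-vanishing : ∀ n (f : ℕ → ℤ) → (∀ {k} → k < n → f k ≡ 0ℤ) →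
                                binomialTransform x f n ≡ f n
  binomialTransform-vanishing zero    f _   = refl
  binomialTransform-vanishing (suc n) f f≡0 = begin
    x * binomialTransform x f n + binomialTransform x (f ∘ suc) n
      ≡⟨ cong₂ (λ u v → x * u + v)
           (binomialTransform-vanishing n f (f≡0 ∘ ℕ.m<n⇒m<1+n))
           (binomialTransform-vanishing n (f ∘ suc) (f≡0 ∘ ℕ.s≤s)) ⟩
    x * f n + f (suc n)      ≡⟨ cong (λ u → x * u + f (suc n)) (f≡0 (ℕ.n<1+n n)) ⟩
    x * 0ℤ + f (suc n)       ≡⟨ cong (_+ f (suc n)) (*-zeroʳ x) ⟩
    0ℤ + f (suc n)           ≡⟨ +-identityˡ (f (suc n)) ⟩
    f (suc n)                ∎

binomialTransform-0 : ∀ n (f : ℕ → ℤ) → binomialTransform 0ℤ f n ≡ f n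
binomialTransform-0 zero    f = refl
binomialTransform-0 (suc n) f = trans (+-identityˡ _) (binomialTransform-0 n (f ∘ suc))

binomialTransform-compose : ∀ x y n (f : ℕ → ℤ) →
  binomialTransform x (binomialTransform y f) n ≡ binomialTransform (x + y) f n
binomialTransform-compose x y zero    f = refl
binomialTransform-compose x y (suc n) f = begin
  x * Tx Ty n + binomialTransform x (λ k → y * Ty k + Ty′ k) n
    ≡⟨ cong (_+_ (x * Tx Ty n)) (binomialTransform-linear x n y Ty Ty′) ⟩
  x * Tx Ty n + (y * Tx Ty n + Tx Ty′ n)
    ≡⟨ cong₂ (λ u v → x * u + (y * u + v))
         (binomialTransform-compose x y n f) (binomialTransform-compose x y n (f ∘ suc)) ⟩
  x * Txy f n + (y * Txy f n + Txy (f ∘ suc) n)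
    ≡⟨ collect x y (Txy f n) (Txy (f ∘ suc) n) ⟩
  (x + y) * Txy f n + Txy (f ∘ suc) n ∎
  where
  Tx Txy : (ℕ → ℤ) → ℕ → ℤ
  Tx = binomialTransform x
  Txy = binomialTransform (x + y)
  Ty Ty′ : ℕ → ℤ
  Ty = binomialTransform y f
  Ty′ = binomialTransform y (f ∘ suc)
  collect : ∀ x y a b → x * a + (y * a + b) ≡ (x + y) * a + b
  collect = solve-∀

binomialTransform-alternating : ∀ x n c (f : ℕ → ℤ) →
  binomialTransform (- x) (λ k → c * -1ℤ ^ k * f k) n ≡ c * -1ℤ ^ n * binomialTransform x f n
binomialTransform-alternating x zero    c f = refl
binomialTransform-alternating x (suc n) c f = begin
  - x * binomialTransform (- x) (λ k → c * -1ℤ ^ k * f k) n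
    + binomialTransform (- x) (λ k → c * -1ℤ ^ suc k * f (suc k)) n
    ≡⟨ cong (_+_ (- x * binomialTransform (- x) (λ k → c * -1ℤ ^ k * f k) n))
         (binomialTransform-cong (- x) n (λ k → move-sign c (-1ℤ ^ k) (f (suc k)))) ⟩
  - x * binomialTransform (- x) (λ k → c * -1ℤ ^ k * f k) n
    + binomialTransform (- x) (λ k → - c * -1ℤ ^ k * f (suc k)) n
    ≡⟨ cong₂ (λ u v → - x * u + v)
         (binomialTransform-alternating x n c f)
         (binomialTransform-alternating x n (- c) (f ∘ suc)) ⟩
  - x * (c * -1ℤ ^ n * binomialTransform x f n) + - c * -1ℤ ^ n * binomialTransform x (f ∘ suc) n
    ≡⟨ regroup x c (-1ℤ ^ n) _ _ ⟩
  c * -1ℤ ^ suc n * binomialTransform x f (suc n) ∎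
  where
  move-sign : ∀ c s a → c * (-1ℤ * s) * a ≡ - c * s * a
  move-sign = solve-∀
  regroup : ∀ x c s a b → - x * (c * s * a) + - c * s * b ≡ c * (-1ℤ * s) * (x * a + b)
  regroup = solve-∀

binomialWeight : ℕ → ℕ → ℕ → ℕ
binomialWeight x n k = (n C k) *ℕ x ^ℕ (n ∸ k)

binomialWeight-pascal : ∀ x n k →
  binomialWeight x (suc n) (suc k) ≡ binomialWeight x n k +ℕ (n C suc k) *ℕ x ^ℕ (n ∸ k)
binomialWeight-pascal x n k = begin
  (suc n C suc k) *ℕ x ^ℕ (n ∸ k)
    ≡⟨ cong (_*ℕ x ^ℕ (n ∸ k)) (sym (nCk+nC[k+1]≡[n+1]C[k+1] n k)) ⟩
  (n C k +ℕ n C suc k) *ℕ x ^ℕ (n ∸ k)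
    ≡⟨ ℕ.*-distribʳ-+ (x ^ℕ (n ∸ k)) (n C k) (n C suc k) ⟩
  binomialWeight x n k +ℕ (n C suc k) *ℕ x ^ℕ (n ∸ k) ∎

binomialWeight-diagonal : ∀ x n → binomialWeight x n n ≡ 1
binomialWeight-diagonal x n rewrite nCn≡1 n | ℕ.n∸n≡0 n = refl

*-^-suc : ∀ c x e → c *ℕ x ^ℕ suc e ≡ x *ℕ (c *ℕ x ^ℕ e)
*-^-suc c x e = begin
  c *ℕ (x *ℕ x ^ℕ e)   ≡⟨ sym (ℕ.*-assoc c x (x ^ℕ e)) ⟩
  c *ℕ x *ℕ x ^ℕ e     ≡⟨ cong (_*ℕ x ^ℕ e) (ℕ.*-comm c x) ⟩
  x *ℕ c *ℕ x ^ℕ e     ≡⟨ ℕ.*-assoc x c (x ^ℕ e) ⟩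
  x *ℕ (c *ℕ x ^ℕ e)   ∎

-- Valid for every k: when k > n both sides vanish with C(n,k).
binomialWeight-suc-exponent : ∀ x n k → (n C k) *ℕ x ^ℕ (suc n ∸ k) ≡ x *ℕ binomialWeight x n k
binomialWeight-suc-exponent x n k with k ℕ.≤? n
... | yes k≤n rewrite ℕ.+-∸-assoc 1 k≤n = *-^-suc (n C k) x (n ∸ k)
... | no k≰n  rewrite k>n⇒nCk≡0 (ℕ.≰⇒> k≰n) = sym (ℕ.*-zeroʳ x)

binomialWeight-below : ∀ x {n k} → k < n → binomialWeight x n k ≡ x *ℕ ((n C k) *ℕ x ^ℕ (n ∸ suc k))
binomialWeight-below x {n} {k} k<n =
  trans (cong (λ e → (n C k) *ℕ x ^ℕ e) (ℕ.+-∸-assoc 1 k<n)) (*-^-suc (n C k) x (n ∸ suc k))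

*-pos-+ : ∀ a m n → a * + (m +ℕ n) ≡ a * + m + a * + n
*-pos-+ a m n = trans (cong (a *_) (pos-+ m n)) (*-distribˡ-+ a (+ m) (+ n))

*-pos-* : ∀ a x c → a * + (x *ℕ c) ≡ + x * (a * + c)
*-pos-* a x c = trans (cong (a *_) (pos-* x c)) (swap a (+ x) (+ c))
  where
  swap : ∀ a x c → a * (x * c) ≡ x * (a * c)
  swap = solve-∀

Σ<-binomial-suc-exponent : ∀ x n (f : ℕ → ℤ) →
  Σ< (suc (suc n)) (λ j → f j * + ((n C j) *ℕ x ^ℕ (suc n ∸ j)))
    ≡ + x * Σ< (suc n) (λ j → f j * + binomialWeight x n j)
Σ<-binomial-suc-exponent x n f = begin
  Σ< (suc (suc n)) (λ j → f j * + ((n C j) *ℕ x ^ℕ (suc n ∸ j)))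
    ≡⟨ Σ<-cong (suc (suc n)) (λ {j} _ → factor j) ⟩
  Σ< (suc (suc n)) (λ j → + x * term j)
    ≡⟨ sym (*-distribˡ-Σ< (suc (suc n)) (+ x) term) ⟩
  + x * Σ< (suc (suc n)) term
    ≡⟨ cong (+ x *_) (Σ<-last (suc n) term) ⟩
  + x * (Σ< (suc n) term + term (suc n))
    ≡⟨ cong (λ t → + x * (Σ< (suc n) term + t)) last-term≡0 ⟩
  + x * (Σ< (suc n) term + 0ℤ)
    ≡⟨ cong (+ x *_) (+-identityʳ (Σ< (suc n) term)) ⟩
  + x * Σ< (suc n) term ∎
  where
  term : ℕ → ℤ
  term j = f j * + binomialWeight x n j
  factor : ∀ j → f j * + ((n C j) *ℕ x ^ℕ (suc n ∸ j)) ≡ + x * term j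
  factor j = trans (cong (λ m → f j * + m) (binomialWeight-suc-exponent x n j)) (*-pos-* (f j) x _)
  last-term≡0 : term (suc n) ≡ 0ℤ
  last-term≡0 = trans (cong (λ c → f (suc n) * + (c *ℕ x ^ℕ (n ∸ suc n))) (k>n⇒nCk≡0 (ℕ.n<1+n n)))
                      (*-zeroʳ (f (suc n)))

Σ<-binomial : ∀ x n (f : ℕ → ℤ) →
  Σ< (suc n) (λ k → f k * + binomialWeight x n k) ≡ binomialTransform (+ x) f n
Σ<-binomial x zero    f = trans (+-identityʳ _) (*-identityʳ (f 0))
Σ<-binomial x (suc n) f = begin
  head + Σ< (suc n) (λ k → f (suc k) * + w (suc n) (suc k))
    ≡⟨ cong (_+_ head) (Σ<-cong (suc n) (λ {k} _ → pascal k)) ⟩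
  head + Σ< (suc n) (λ k → f (suc k) * + w n k + shifted (suc k))
    ≡⟨ cong (_+_ head) (Σ<-distrib-+ (suc n) (λ k → f (suc k) * + w n k) (shifted ∘ suc)) ⟩
  head + (Σ< (suc n) (λ k → f (suc k) * + w n k) + Σ< (suc n) (shifted ∘ suc))
    ≡⟨ left-comm head (Σ< (suc n) (λ k → f (suc k) * + w n k)) (Σ< (suc n) (shifted ∘ suc)) ⟩
  Σ< (suc n) (λ k → f (suc k) * + w n k) + Σ< (suc (suc n)) shifted
    ≡⟨ cong₂ _+_ (Σ<-binomial x n (f ∘ suc))
                 (trans (Σ<-binomial-suc-exponent x n f) (cong (+ x *_) (Σ<-binomial x n f))) ⟩
  binomialTransform (+ x) (f ∘ suc) n + + x * binomialTransform (+ x) f n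
    ≡⟨ +-comm (binomialTransform (+ x) (f ∘ suc) n) (+ x * binomialTransform (+ x) f n) ⟩
  binomialTransform (+ x) f (suc n) ∎
  where
  w : ℕ → ℕ → ℕ
  w = binomialWeight x
  head : ℤ
  head = f 0 * + w (suc n) 0
  shifted : ℕ → ℤ
  shifted j = f j * + ((n C j) *ℕ x ^ℕ (suc n ∸ j))
  pascal : ∀ k → f (suc k) * + w (suc n) (suc k) ≡ f (suc k) * + w n k + shifted (suc k)
  pascal k = trans (cong (λ m → f (suc k) * + m) (binomialWeight-pascal x n k)) (*-pos-+ (f (suc k)) _ _)
  left-comm : ∀ a b c → a + (b + c) ≡ b + (a + c)
  left-comm = solve-∀

Σ<-binomialWeight-below : ∀ x m (f : ℕ → ℤ) →
  Σ< m (λ k → f k * + binomialWeight x m k) ≡ + x * Σ< m (λ k → f k * + ((m C k) *ℕ x ^ℕ (m ∸ suc k)))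
Σ<-binomialWeight-below x m f =
  trans (Σ<-cong m factor) (sym (*-distribˡ-Σ< m (+ x) _))
  where
  factor : ∀ {k} → k < m →
           f k * + binomialWeight x m k ≡ + x * (f k * + ((m C k) *ℕ x ^ℕ (m ∸ suc k)))
  factor {k} k<m = trans (cong (λ w → f k * + w) (binomialWeight-below x k<m)) (*-pos-* (f k) x _)

[i*2]/2≡i : ∀ i → (i * + 2) / + 2 ≡ i
[i*2]/2≡i (+ n) =
  trans (cong (_/ + 2) (sym (pos-* n 2))) (trans (*-identityˡ _) (cong +_ (ℕ.m*n/n≡m n 2)))
[i*2]/2≡i -[1+ n ] with suc (suc (n *ℕ 2)) ℕ.% 2 | ℕ.m*n%n≡0 (suc n) 2
... | .0 | refl = trans (*-identityˡ _) (cong (λ m → - (+ m)) (ℕ.m*n/n≡m (suc n) 2))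

length-prefix : ∀ n → length (prefix n) ≡ n
length-prefix zero    = refl
length-prefix (suc n) = begin
  length (prefix n ++ [ aG n ])   ≡⟨ List.length-++ (prefix n) ⟩
  length (prefix n) +ℕ 1          ≡⟨ ℕ.+-comm (length (prefix n)) 1 ⟩
  suc (length (prefix n))         ≡⟨ cong suc (length-prefix n) ⟩
  suc n                           ∎

at-++ˡ : ∀ (xs ys : List ℤ) {k} → k < length xs → at (xs ++ ys) k ≡ at xs k
at-++ˡ (x ∷ xs) ys {zero}  _           = refl
at-++ˡ (x ∷ xs) ys {suc k} (ℕ.s≤s k<n) = at-++ˡ xs ys k<n

at-length-∷ʳ : ∀ (xs : List ℤ) y → at (xs ++ [ y ]) (length xs) ≡ y
at-length-∷ʳ []       y = refl
at-length-∷ʳ (x ∷ xs) y = at-length-∷ʳ xs y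

at-prefix : ∀ {n k} → k < n → at (prefix n) k ≡ aG k
at-prefix {suc n} {k} k<1+n with ℕ.m<1+n⇒m<n∨m≡n k<1+n
... | inj₁ k<n  = trans (at-++ˡ (prefix n) [ aG n ] (subst (k <_) (sym (length-prefix n)) k<n))
                        (at-prefix k<n)
... | inj₂ refl = subst (λ j → at (prefix (suc k)) j ≡ aG k) (length-prefix k)
                        (at-length-∷ʳ (prefix k) (aG k))

bG : ℕ → ℤ
bG = binomialTransform (+ 2) aG

-- (bG n - aG n) / 2, an integer since the weights C(n,k) 2^(n-k) with k < n are even.
halfProperSum : ℕ → ℤ
halfProperSum n = Σ< n (λ k → aG k * + ((n C k) *ℕ 2 ^ℕ (n ∸ suc k)))

bG-split : ∀ n → bG n ≡ + 2 * halfProperSum n + aG n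
bG-split n = begin
  bG n
    ≡⟨ sym (Σ<-binomial 2 n aG) ⟩
  Σ< (suc n) (λ k → aG k * + binomialWeight 2 n k)
    ≡⟨ Σ<-last n (λ k → aG k * + binomialWeight 2 n k) ⟩
  Σ< n (λ k → aG k * + binomialWeight 2 n k) + aG n * + binomialWeight 2 n n
    ≡⟨ cong₂ _+_ (Σ<-binomialWeight-below 2 n aG)
                 (trans (cong (λ m → aG n * + m) (binomialWeight-diagonal 2 n)) (*-identityʳ (aG n))) ⟩
  + 2 * halfProperSum n + aG n ∎

sum-in-step : ∀ {m N} → m ≤ N →
  sumℤ (map (λ k → at (prefix N) k * + binomialWeight 2 m k) (upTo m)) ≡ + 2 * halfProperSum m
sum-in-step {m} {N} m≤N = begin
  sumℤ (map (λ k → at (prefix N) k * + binomialWeight 2 m k) (upTo m))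
    ≡⟨ sumℤ-map-applyUpTo m (λ k → k) _ ⟩
  Σ< m (λ k → at (prefix N) k * + binomialWeight 2 m k)
    ≡⟨ Σ<-cong m (λ {k} k<m → cong (λ a → a * + binomialWeight 2 m k) (at-prefix (ℕ.<-≤-trans k<m m≤N))) ⟩
  Σ< m (λ k → aG k * + binomialWeight 2 m k)
    ≡⟨ Σ<-binomialWeight-below 2 m aG ⟩
  + 2 * halfProperSum m ∎

aG-recurrence : ∀ m → aG (suc m) ≡ aG m - bG m - bG (suc m)
aG-recurrence 0 = refl
aG-recurrence 1 = refl
aG-recurrence m@(suc (suc _)) = begin
  aG n
    ≡⟨ aG-halves ⟩
  - (Y m + Y n)
    ≡⟨ expand (aG m) (Y m) (Y n) ⟩
  aG m - (+ 2 * Y m + aG m) - (+ 2 * Y n + - (Y m + Y n))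
    ≡⟨ cong (λ a → aG m - (+ 2 * Y m + aG m) - (+ 2 * Y n + a)) (sym aG-halves) ⟩
  aG m - (+ 2 * Y m + aG m) - (+ 2 * Y n + aG n)
    ≡⟨ sym (cong₂ (λ u v → aG m - u - v) (bG-split m) (bG-split n)) ⟩
  aG m - bG m - bG n ∎
  where
  n : ℕ
  n = suc m
  Y : ℕ → ℤ
  Y = halfProperSum
  sum-up-to : ℕ → ℤ
  sum-up-to j = sumℤ (map (λ k → at (prefix n) k * + binomialWeight 2 j k) (upTo j))
  aG-halves : aG n ≡ - (Y m + Y n)
  aG-halves = cong -_ (begin
    (sum-up-to m + sum-up-to n) / + 2
      ≡⟨ cong (_/ + 2) (cong₂ _+_ (sum-in-step (ℕ.n≤1+n m)) (sum-in-step {n} {n} ℕ.≤-refl)) ⟩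
    (+ 2 * Y m + + 2 * Y n) / + 2
      ≡⟨ cong (_/ + 2) (trans (sym (*-distribˡ-+ (+ 2) (Y m) (Y n))) (*-comm (+ 2) (Y m + Y n))) ⟩
    ((Y m + Y n) * + 2) / + 2
      ≡⟨ [i*2]/2≡i (Y m + Y n) ⟩
    Y m + Y n ∎)
  expand : ∀ a y z → - (y + z) ≡ a - (+ 2 * y + a) - (+ 2 * z + - (y + z))
  expand = solve-∀

-1^n-dichotomy : ∀ n → -1ℤ ^ n ≡ 1ℤ ⊎ -1ℤ ^ n ≡ -1ℤ
-1^n-dichotomy zero = inj₁ refl
-1^n-dichotomy (suc n) with -1^n-dichotomy n
... | inj₁ e = inj₂ (cong (-1ℤ *_) e)
... | inj₂ e = inj₁ (cong (-1ℤ *_) e)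

-1^n*-1^n≡1 : ∀ n → -1ℤ ^ n * -1ℤ ^ n ≡ 1ℤ
-1^n*-1^n≡1 n with -1^n-dichotomy n
... | inj₁ e rewrite e = refl
... | inj₂ e rewrite e = refl

-1^[2*n]≡1 : ∀ n → -1ℤ ^ (2 *ℕ n) ≡ 1ℤ
-1^[2*n]≡1 n = trans (sym (^-*-assoc -1ℤ 2 n)) (^-zeroˡ n)

2*i≡i+i : ∀ i → + 2 * i ≡ i + i
2*i≡i+i = solve-∀

i+i≡0⇒i≡0 : ∀ i → i + i ≡ 0ℤ → i ≡ 0ℤ
i+i≡0⇒i≡0 i i+i≡0 = *-cancelˡ-≡ (+ 2) i 0ℤ (trans (2*i≡i+i i) i+i≡0)

defect : ℕ → ℤ
defect n = bG n - -1ℤ ^ n * aG n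

defect-involution : ∀ n → -1ℤ ^ n * defect n + binomialTransform (- + 2) defect n ≡ 0ℤ
defect-involution n = begin
  s * defect n + binomialTransform (- + 2) defect n
    ≡⟨ cong (_+_ (s * defect n))
         (binomialTransform-cong (- + 2) n (λ k → split (bG k) (-1ℤ ^ k) (aG k))) ⟩
  s * defect n + binomialTransform (- + 2) (λ k → 1ℤ * bG k + -1ℤ * -1ℤ ^ k * aG k) n
    ≡⟨ cong (_+_ (s * defect n))
         (binomialTransform-linear (- + 2) n 1ℤ bG (λ k → -1ℤ * -1ℤ ^ k * aG k)) ⟩
  s * defect n + (1ℤ * binomialTransform (- + 2) bG n
                  + binomialTransform (- + 2) (λ k → -1ℤ * -1ℤ ^ k * aG k) n)
    ≡⟨ cong₂ (λ u v → s * defect n + (1ℤ * u + v))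
         (trans (binomialTransform-compose (- + 2) (+ 2) n aG) (binomialTransform-0 n aG))
         (binomialTransform-alternating (+ 2) n -1ℤ aG) ⟩
  s * (bG n - s * aG n) + (1ℤ * aG n + -1ℤ * s * bG n)
    ≡⟨ collect s (aG n) (bG n) ⟩
  (1ℤ - s * s) * aG n
    ≡⟨ cong (λ t → (1ℤ - t) * aG n) (-1^n*-1^n≡1 n) ⟩
  0ℤ ∎
  where
  s : ℤ
  s = -1ℤ ^ n
  split : ∀ b s a → b - s * a ≡ 1ℤ * b + -1ℤ * s * a
  split = solve-∀
  collect : ∀ s a b → s * (b - s * a) + (1ℤ * a + -1ℤ * s * b) ≡ (1ℤ - s * s) * a
  collect = solve-∀

-- The sign of m decides the parity of suc m: if it is even, defect-involution gives
-- 2 · defect (suc m) = 0; if it is odd, aG-recurrence does.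
defect-vanishes : ∀ n → (∀ {k} → k < n → defect k ≡ 0ℤ) → defect n ≡ 0ℤ
defect-vanishes zero    _  = refl
defect-vanishes (suc m) ih with -1^n-dichotomy m
... | inj₂ s≡-1 = i+i≡0⇒i≡0 (defect (suc m)) (begin
  defect (suc m) + defect (suc m)
    ≡⟨ cong (_+ defect (suc m)) (sym (*-identityˡ (defect (suc m)))) ⟩
  1ℤ * defect (suc m) + defect (suc m)
    ≡⟨ cong (λ s → -1ℤ * s * defect (suc m) + defect (suc m)) (sym s≡-1) ⟩
  -1ℤ ^ suc m * defect (suc m) + defect (suc m)
    ≡⟨ cong (_+_ (-1ℤ ^ suc m * defect (suc m)))
         (sym (binomialTransform-vanishing (- + 2) (suc m) defect ih)) ⟩
  -1ℤ ^ suc m * defect (suc m) + binomialTransform (- + 2) defect (suc m)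
    ≡⟨ defect-involution (suc m) ⟩
  0ℤ ∎)
... | inj₁ s≡1 = begin
  bG (suc m) - -1ℤ * -1ℤ ^ m * aG (suc m)
    ≡⟨ cong₂ (λ s a → bG (suc m) - -1ℤ * s * a) s≡1 (aG-recurrence m) ⟩
  bG (suc m) - -1ℤ * 1ℤ * (aG m - bG m - bG (suc m))
    ≡⟨ cancel (aG m) (bG m) (bG (suc m)) ⟩
  - (bG m - 1ℤ * aG m)
    ≡⟨ cong (λ s → - (bG m - s * aG m)) (sym s≡1) ⟩
  - defect m
    ≡⟨ cong -_ (ih (ℕ.n<1+n m)) ⟩
  0ℤ ∎
  where
  cancel : ∀ a b b′ → b′ - -1ℤ * 1ℤ * (a - b - b′) ≡ - (b - 1ℤ * a)
  cancel = solve-∀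

bG≡-1^n*aG : ∀ n → bG n ≡ -1ℤ ^ n * aG n
bG≡-1^n*aG n = i-j≡0⇒i≡j (bG n) (-1ℤ ^ n * aG n) (<-rec (λ k → defect k ≡ 0ℤ) defect-vanishes n)

aG-suc-odd : ∀ m → -1ℤ ^ m ≡ -1ℤ → aG (suc m) ≡ aG m
aG-suc-odd m odd = *-cancelˡ-≡ (+ 2) (aG (suc m)) (aG m) (begin
  + 2 * A
    ≡⟨ 2*i≡i+i A ⟩
  A + A
    ≡⟨ cong (_+_ A) (aG-recurrence m) ⟩
  A + (a - bG m - bG (suc m))
    ≡⟨ cong₂ (λ u v → A + (a - u - v)) (bG≡-1^n*aG m) (bG≡-1^n*aG (suc m)) ⟩
  A + (a - -1ℤ ^ m * a - -1ℤ * -1ℤ ^ m * A)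
    ≡⟨ cong (λ s → A + (a - s * a - -1ℤ * s * A)) odd ⟩
  A + (a - -1ℤ * a - -1ℤ * -1ℤ * A)
    ≡⟨ simplify A a ⟩
  + 2 * a ∎)
  where
  A a : ℤ
  A = aG (suc m)
  a = aG m
  simplify : ∀ A a → A + (a - -1ℤ * a - -1ℤ * -1ℤ * A) ≡ + 2 * a
  simplify = solve-∀

mainTheorem17 : (n : ℕ) → aG (2 *ℕ suc n) ≡ aG (suc (2 *ℕ n))
mainTheorem17 n = begin
  aG (2 *ℕ suc n)         ≡⟨ cong aG (ℕ.*-suc 2 n) ⟩
  aG (suc (suc (2 *ℕ n))) ≡⟨ aG-suc-odd (suc (2 *ℕ n)) (cong (-1ℤ *_) (-1^[2*n]≡1 n)) ⟩
  aG (suc (2 *ℕ n))       ∎
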